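{- If a tree sequent $\Gamma\stackrel{\mathcal{T}}{\Rightarrow}\Delta$ is provable in $\mathsf{T}\mathbf{EFL}$, then $\mathfrak{M},f\models\Gamma\stackrel{\mathcal{T}}{\Rightarrow}\Delta$ for all models $\mathfrak{M}$ and all $\mathcal{T}$-assignments $f$ in $\mathfrak{M}$.
   Context: Syntax. Disjoint countably infinite sets $\mathsf{Prop}$ and $\mathsf{Nom}$ (agent nominals). Formulas: $\varphi ::= n \mid p \mid \bot \mid \varphi\to\varphi \mid @_{n}\varphi \mid \mathsf{F}\varphi \mid \Box\varphi$; $\neg\varphi:=\varphi\to\bot$; $\langle\mathsf{F}\rangle\varphi:=\neg\mathsf{F}\neg\varphi$. $@$-prefixed formulas have the form $@_n\varphi$. $\varphi[m/k]$ replaces every occurrence of nominal $k$ by $m$. Semantics. A model $\mathfrak{M}=(W,A,(R_a)_{a\in A},(\asymp_w)_{w\in W},V)$: $W,A$ nonempty, $R_a\subseteq W\times W$, $\asymp_w\subseteq A\times A$, $V:\mathsf{Prop}\cup\mathsf{Nom}\to\mathcal{P}(W\times A)$ with $V(n)=W\times\{\underline n\}$ for a unique $\underline n\in A$. Satisfaction: $(w,a)\models p$ iff $(w,a)\in V(p)$; $(w,a)\models n$ iff $\underline n=a$; $\bot$ never; $\to$ classical; $(w,a)\models@_n\varphi$ iff $(w,\underline n)\models\varphi$; $(w,a)\models\mathsf{F}\varphi$ iff $(w,b)\models\varphi$ for all $b$ with $a\asymp_wb$; $(w,a)\models\Box\varphi$ iff $(v,a)\models\varphi$ for all $v$ with $wR_av$.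 Tree sequents. Labels: natural numbers, and $\alpha\cdot_ni$ (an $n$-child of $\alpha$) for label $\alpha$, nominal $n$, $i\in\mathbb{N}$. A tree: set of labels containing exactly one natural number (root), closed under parents. Labelled formula: $\alpha:\psi$, $\psi$ $@$-prefixed. Tree sequent $\Gamma\stackrel{\mathcal{T}}{\Rightarrow}\Delta$: finite sets of labelled formulas, finite tree containing their labels. $\mathcal{T}$-assignment: $f:\mathcal{T}\to W$ with $f(\alpha)R_{\underline n}f(\beta)$ whenever $\beta\in\mathcal{T}$ is an $n$-child of $\alpha$. $\mathfrak{M},f\models\alpha:@_n\varphi$ iff $(f(\alpha),\underline n)\models\varphi$; $\mathfrak{M},f\models\Gamma\stackrel{\mathcal{T}}{\Rightarrow}\Delta$ iff truth of all of $\Gamma$ implies truth of some member of $\Delta$. Calculus $\mathsf{T}\mathbf{EFL}$ ($\alpha,\beta\in\mathcal{T}$; tree unchanged unless indicated). Initial: $\alpha:@_n\bot,\Gamma\Rightarrow\Delta$; $\alpha:@_n\varphi,\Gamma\Rightarrow\Delta,\alpha:@_n\varphi$. Rules (premises / conclusion): $(\mathsf{rep}_{=1})$ $\alpha:@_nm,\alpha:\varphi[n/k],\Gamma\Rightarrow\Delta$ / $\alpha:@_nm,\alpha:\varphi[m/k],\Gamma\Rightarrow\Delta$; $(\mathsf{rep}_{=2})$ $\alpha:@_nm,\alpha:\varphi[m/k],\Gamma\Rightarrow\Delta$ / $\alpha:@_nm,\alpha:\varphi[n/k],\Gamma\Rightarrow\Delta$; $(\mathsf{ref}_=)$ $\alpha:@_nn,\Gamma\Rightarrow\Delta$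 / $\Gamma\Rightarrow\Delta$; $(\mathsf{rigid}_=)$ $\beta:@_nm,\Gamma\Rightarrow\Delta$ / $\alpha:@_nm,\Gamma\Rightarrow\Delta$; $(\to R)$ $\alpha:@_n\varphi,\Gamma\Rightarrow\Delta,\alpha:@_n\psi$ / $\Gamma\Rightarrow\Delta,\alpha:@_n(\varphi\to\psi)$; $(\to L)$ $\Gamma\Rightarrow\Delta,\alpha:@_n\varphi$ and $\alpha:@_n\psi,\Gamma\Rightarrow\Delta$ / $\alpha:@_n(\varphi\to\psi),\Gamma\Rightarrow\Delta$; $(@R)$ $\Gamma\Rightarrow\Delta,\alpha:@_m\varphi$ / $\Gamma\Rightarrow\Delta,\alpha:@_n@_m\varphi$; $(@L)$ $\alpha:@_m\varphi,\Gamma\Rightarrow\Delta$ / $\alpha:@_n@_m\varphi,\Gamma\Rightarrow\Delta$; $(\mathsf{F}R)$ $\alpha:@_n\langle\mathsf{F}\rangle m,\Gamma\Rightarrow\Delta,\alpha:@_m\varphi$ / $\Gamma\Rightarrow\Delta,\alpha:@_n\mathsf{F}\varphi$, $m$ not occurring in the conclusion; $(\mathsf{F}L)$ $\Gamma\Rightarrow\Delta,\alpha:@_n\langle\mathsf{F}\rangle m$ and $\alpha:@_m\varphi,\Gamma\Rightarrow\Delta$ / $\alpha:@_n\mathsf{F}\varphi,\Gamma\Rightarrow\Delta$; $(\Box R)$ $\Gamma\stackrel{\mathcal{T}\cup\{\alpha\cdot_ni\}}{\Rightarrow}\Delta,\alpha\cdot_ni:@_n\varphi$ / $\Gamma\stackrel{\mathcal{T}}{\Rightarrow}\Delta,\alpha:@_n\Box\varphi$,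 $i$ fresh in the conclusion; $(\Box L)$ $\beta:@_n\varphi,\Gamma\Rightarrow\Delta$ / $\alpha:@_n\Box\varphi,\Gamma\Rightarrow\Delta$, $\beta$ an $n$-child of $\alpha$; $(w\mathsf{lab})$ $\Gamma\stackrel{\mathcal{T}}{\Rightarrow}\Delta$ / $\Gamma\stackrel{\mathcal{T}\cup\{\alpha\}}{\Rightarrow}\Delta$ if $\mathcal{T}\cup\{\alpha\}$ is a tree; $(Cut)$ $\Gamma\Rightarrow\Delta,\alpha:@_n\varphi$ and $\alpha:@_n\varphi,\Pi\Rightarrow\Sigma$ / $\Gamma,\Pi\Rightarrow\Delta,\Sigma$. Provable = root of a finite derivation. -}

module Defs where

open import Level using (0ℓ)
open import Data.Nat using (ℕ; _≟_)
open import Data.Bool using (if_then_else_)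
open import Data.Product using (Σ; _×_; _,_)
open import Data.Sum using (_⊎_)
open import Data.Empty using (⊥)
open import Data.List using (List; []; _∷_; _++_)
open import Data.List.Relation.Unary.All using (All)
open import Data.List.Relation.Unary.Any using (Any)
open import Data.List.Membership.Propositional using (_∈_; _∉_)
open import Relation.Nullary using (¬_; does)
open import Relation.Binary.PropositionalEquality using (_≡_)

-- Propositional variables and agent nominals: two disjoint countably
-- infinite sets (kept apart by the constructors of Fm).
PropVar : Set
PropVar = ℕ

Nom : Set
Nom = ℕ

infixr 5 _⇒_
data Fm : Set where
  nom  : Nom → Fm
  var  : PropVar → Fm
  ⊥'   : Fm
  _⇒_  : Fm → Fm → Fm
  at   : Nom → Fm → Fm
  F    : Fm → Fm
  □    : Fm → Fm

¬' : Fm → Fm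
¬' φ = φ ⇒ ⊥'

⟨F⟩ : Fm → Fm
⟨F⟩ φ = ¬' (F (¬' φ))

subN : Nom → Nom → Nom → Nom
subN m k x = if does (x ≟ k) then m else x

subF : Nom → Nom → Fm → Fm
subF m k (nom x)   = nom (subN m k x)
subF m k (var p)   = var p
subF m k ⊥'        = ⊥'
subF m k (φ ⇒ ψ)   = subF m k φ ⇒ subF m k ψ
subF m k (at x φ)  = at (subN m k x) (subF m k φ)
subF m k (F φ)     = F (subF m k φ)
subF m k (□ φ)     = □ (subF m k φ)

record Model : Set₁ where
  field
    W     : Set
    A     : Set
    w₀    : W
    a₀    : A
    R     : A → W → W → Set        -- R a w v  :  w R_a v
    Asy   : W → A → A → Set        -- Asy w a b :  a ≍_w b
    V     : PropVar → W → A → Set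
    den   : Nom → A                -- V(n) = W × {den n}

module _ (M : Model) where
  open Model M

  Sat : W → A → Fm → Set
  Sat w a (nom n)   = den n ≡ a
  Sat w a (var p)   = V p w a
  Sat w a ⊥'        = ⊥
  Sat w a (φ ⇒ ψ)   = Sat w a φ → Sat w a ψ
  Sat w a (at n φ)  = Sat w (den n) φ
  Sat w a (F φ)     = ∀ b → Asy w a b → Sat w b φ
  Sat w a (□ φ)     = ∀ v → R a w v → Sat v a φ

data Label : Set where
  root  : ℕ → Label
  child : Label → Nom → ℕ → Label

-- A finite set of labels (given as a list; only membership matters)
-- is a tree: it contains exactly one natural number and is closed
-- under parents.
record IsTree (T : List Label) : Set where
  field
    hasRoot    : Σ ℕ λ k → root k ∈ T
    uniqueRoot : ∀ k l → root k ∈ T → root l ∈ T → k ≡ l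
    parentClosed : ∀ α n i → child α n i ∈ T → α ∈ T

record LFm : Set where
  constructor lf
  field
    lab  : Label
    nm   : Nom
    body : Fm
open LFm public

WF : List LFm → List Label → List LFm → Set
WF Γ T Δ = IsTree T × All (λ x → lab x ∈ T) Γ × All (λ x → lab x ∈ T) Δ

_≋_ : {X : Set} → List X → List X → Set
xs ≋ ys = ∀ x → (x ∈ xs → x ∈ ys) × (x ∈ ys → x ∈ xs)

OccF : Nom → Fm → Set
OccF m (nom n)   = m ≡ n
OccF m (var p)   = ⊥
OccF m ⊥'        = ⊥
OccF m (φ ⇒ ψ)   = OccF m φ ⊎ OccF m ψ
OccF m (at n φ)  = m ≡ n ⊎ OccF m φ
OccF m (F φ)     = OccF m φ
OccF m (□ φ)     = OccF m φ

OccL : Nom → Label → Set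
OccL m (root k)      = ⊥
OccL m (child α n i) = OccL m α ⊎ m ≡ n

OccLF : Nom → LFm → Set
OccLF m (lf α n φ) = OccL m α ⊎ m ≡ n ⊎ OccF m φ

FreshNom : Nom → List LFm → List Label → List LFm → Set
FreshNom m Γ T Δ = ¬ Any (OccLF m) Γ × ¬ Any (OccLF m) Δ × ¬ Any (OccL m) T

-- Every node of a derivation is a tree sequent
-- (each rule requires WF of its conclusion).  Sequent components are
-- finite sets, represented by lists; the rule `set` identifies lists
-- with the same underlying sets.

data ⊢ : List LFm → List Label → List LFm → Set where
  init⊥ : ∀ {α n Γ T Δ} → WF (lf α n ⊥' ∷ Γ) T Δ →
          ⊢ (lf α n ⊥' ∷ Γ) T Δ
  initId : ∀ {x Γ T Δ} → WF (x ∷ Γ) T (x ∷ Δ) →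
          ⊢ (x ∷ Γ) T (x ∷ Δ)
  rep₁ : ∀ {α n m k j ψ Γ T Δ} →
          WF (lf α n (nom m) ∷ lf α (subN m k j) (subF m k ψ) ∷ Γ) T Δ →
          ⊢ (lf α n (nom m) ∷ lf α (subN n k j) (subF n k ψ) ∷ Γ) T Δ →
          ⊢ (lf α n (nom m) ∷ lf α (subN m k j) (subF m k ψ) ∷ Γ) T Δ
  rep₂ : ∀ {α n m k j ψ Γ T Δ} →
          WF (lf α n (nom m) ∷ lf α (subN n k j) (subF n k ψ) ∷ Γ) T Δ →
          ⊢ (lf α n (nom m) ∷ lf α (subN m k j) (subF m k ψ) ∷ Γ) T Δ →
          ⊢ (lf α n (nom m) ∷ lf α (subN n k j) (subF n k ψ) ∷ Γ) T Δ
  ref= : ∀ {α n Γ T Δ} → WF Γ T Δ → α ∈ T →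
          ⊢ (lf α n (nom n) ∷ Γ) T Δ →
          ⊢ Γ T Δ
  rigid= : ∀ {α β n m Γ T Δ} → WF (lf α n (nom m) ∷ Γ) T Δ → β ∈ T →
          ⊢ (lf β n (nom m) ∷ Γ) T Δ →
          ⊢ (lf α n (nom m) ∷ Γ) T Δ
  ⇒R : ∀ {α n φ ψ Γ T Δ} → WF Γ T (lf α n (φ ⇒ ψ) ∷ Δ) →
          ⊢ (lf α n φ ∷ Γ) T (lf α n ψ ∷ Δ) →
          ⊢ Γ T (lf α n (φ ⇒ ψ) ∷ Δ)
  ⇒L : ∀ {α n φ ψ Γ T Δ} → WF (lf α n (φ ⇒ ψ) ∷ Γ) T Δ →
          ⊢ Γ T (lf α n φ ∷ Δ) →
          ⊢ (lf α n ψ ∷ Γ) T Δ →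
          ⊢ (lf α n (φ ⇒ ψ) ∷ Γ) T Δ
  atR : ∀ {α n m φ Γ T Δ} → WF Γ T (lf α n (at m φ) ∷ Δ) →
          ⊢ Γ T (lf α m φ ∷ Δ) →
          ⊢ Γ T (lf α n (at m φ) ∷ Δ)
  atL : ∀ {α n m φ Γ T Δ} → WF (lf α n (at m φ) ∷ Γ) T Δ →
          ⊢ (lf α m φ ∷ Γ) T Δ →
          ⊢ (lf α n (at m φ) ∷ Γ) T Δ
  FR : ∀ {α n m φ Γ T Δ} → WF Γ T (lf α n (F φ) ∷ Δ) →
          FreshNom m Γ T (lf α n (F φ) ∷ Δ) →
          ⊢ (lf α n (⟨F⟩ (nom m)) ∷ Γ) T (lf α m φ ∷ Δ) →
          ⊢ Γ T (lf α n (F φ) ∷ Δ)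
  FL : ∀ {α n m φ Γ T Δ} → WF (lf α n (F φ) ∷ Γ) T Δ →
          ⊢ Γ T (lf α n (⟨F⟩ (nom m)) ∷ Δ) →
          ⊢ (lf α m φ ∷ Γ) T Δ →
          ⊢ (lf α n (F φ) ∷ Γ) T Δ
  □R : ∀ {α n i φ Γ T Δ} → WF Γ T (lf α n (□ φ) ∷ Δ) →
          child α n i ∉ T →
          ⊢ Γ (child α n i ∷ T) (lf (child α n i) n φ ∷ Δ) →
          ⊢ Γ T (lf α n (□ φ) ∷ Δ)
  □L : ∀ {α n i φ Γ T Δ} → WF (lf α n (□ φ) ∷ Γ) T Δ →
          child α n i ∈ T →
          ⊢ (lf (child α n i) n φ ∷ Γ) T Δ →
          ⊢ (lf α n (□ φ) ∷ Γ) T Δ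
  wlab : ∀ {α Γ T Δ} → WF Γ (α ∷ T) Δ →
          ⊢ Γ T Δ →
          ⊢ Γ (α ∷ T) Δ
  cut : ∀ {x Γ Π Δ Σ' T} → WF (Γ ++ Π) T (Δ ++ Σ') →
          ⊢ Γ T (x ∷ Δ) →
          ⊢ (x ∷ Π) T Σ' →
          ⊢ (Γ ++ Π) T (Δ ++ Σ')
  set : ∀ {Γ T Δ Γ' T' Δ'} → WF Γ' T' Δ' →
          Γ ≋ Γ' → T ≋ T' → Δ ≋ Δ' →
          ⊢ Γ T Δ →
          ⊢ Γ' T' Δ'

module _ (M : Model) where
  open Model M

  -- f is a T-assignment (f is given as a total map on labels; only its
  -- values on T matter).
  IsAssignment : List Label → (Label → W) → Set
  IsAssignment T f = ∀ α n i → child α n i ∈ T → R (den n) (f α) (f (child α n i))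

  TrueLF : (Label → W) → LFm → Set
  TrueLF f (lf α n φ) = Sat M (f α) (den n) φ

  TrueSeq : (Label → W) → List LFm → List LFm → Set
  TrueSeq f Γ Δ = All (TrueLF f) Γ → Any (TrueLF f) Δ

-- Soundness is proved rule by rule: every rule of T EFL turns valid
-- premises (true under all models and all T-assignments) into a valid
-- conclusion.  The right rules ⇒R, FR and □R are read classically: if no
-- side formula of Δ holds, the principal formula must.  For FR the fresh
-- nominal m is reinterpreted as an arbitrary F-successor b; as m occurs
-- nowhere in the conclusion, that conclusion keeps its truth value.  For □R
-- the assignment is extended to the fresh child label by an arbitrary
-- R-successor v; it agrees with the old assignment on the labels of T.
module Submission where

open import Defs
open import Level using (0ℓ)
open import Axiom.ExcludedMiddle using (ExcludedMiddle)
open import Function using (_∘_; id)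
open import Data.Nat as ℕ using (ℕ)
open import Data.Bool using (true; false; if_then_else_)
open import Data.Product using (_,_; proj₁)
open import Data.Sum using (inj₁; inj₂; [_,_]′)
open import Data.List using (List; _∷_; _++_)
open import Data.List.Relation.Unary.All as All using (All; _∷_)
open import Data.List.Relation.Unary.All.Properties using (¬Any⇒All¬; ++⁻)
open import Data.List.Relation.Unary.Any as Any using (Any; here; there)
open import Data.List.Relation.Unary.Any.Properties using (++⁺ˡ; ++⁺ʳ)
open import Data.List.Membership.Propositional using (_∈_; _∉_; find; lose)
open import Data.List.Relation.Binary.Subset.Propositional using (_⊆_)
open import Data.List.Relation.Binary.Subset.Propositional.Properties
  using (Any-resp-⊆; All-resp-⊇)
open import Relation.Nullary using (¬_; does; yes; no; contradiction)
open import Relation.Binary.Definitions using (DecidableEquality)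
open import Relation.Binary.PropositionalEquality
  using (_≡_; refl; sym; trans; subst; subst₂)

private variable
  X : Set
  P P′ Q : X → Set
  xs ys : List X
  Γ Δ Π Σ′ : List LFm
  T T′ : List Label
  α β : Label
  n m k j : Nom
  i : ℕ
  φ ψ : Fm
  ι : LFm

Any-map-under-All : All Q xs → (∀ {x} → Q x → P x → P′ x) → Any P xs → Any P′ xs
Any-map-under-All qs g a with find a
... | x , x∈xs , px = lose x∈xs (g (All.lookup qs x∈xs) px)

≋⇒⊆ : xs ≋ ys → xs ⊆ ys
≋⇒⊆ xs≋ys {x} = proj₁ (xs≋ys x)

Any-∷-classical : ExcludedMiddle 0ℓ → {x : X} → (¬ Any P xs → P x) → Any P (x ∷ xs)
Any-∷-classical {P = P} {xs = xs} em h with em {Any P xs}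
... | yes a  = there a
... | no ¬a  = here (h ¬a)

module Update {X : Set} (_≟_ : DecidableEquality X) {Y : Set} where

  _[_]≔_ : (X → Y) → X → Y → X → Y
  (f [ c ]≔ v) x = if does (x ≟ c) then v else f x

  []≔-updates : (f : X → Y) (c : X) (v : Y) → (f [ c ]≔ v) c ≡ v
  []≔-updates f c v with c ≟ c
  ... | yes _    = refl
  ... | no c≢c  = contradiction refl c≢c

  []≔-outside : {R : X → Set} {f : X → Y} {c x : X} {v : Y} →
                ¬ R c → R x → (f [ c ]≔ v) x ≡ f x
  []≔-outside {R = R} {c = c} {x} ¬Rc Rx with x ≟ c
  ... | yes x≡c  = contradiction (subst R x≡c Rx) ¬Rc
  ... | no _     = refl

withDen : (M : Model) → (Nom → Model.A M) → Model
withDen M d = record M { den = d }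

module _ (M : Model) where
  open Model M

  Sat-den-cong : {d d′ : Nom → A} (φ : Fm) → (∀ x → OccF x φ → d x ≡ d′ x) →
                 {w : W} {a : A} → Sat (withDen M d) w a φ → Sat (withDen M d′) w a φ
  Sat-den-cong (nom x)  agree h = trans (sym (agree x refl)) h
  Sat-den-cong (var p)  agree h = h
  Sat-den-cong ⊥'       agree h = h
  Sat-den-cong (φ ⇒ ψ)  agree h =
    Sat-den-cong ψ (λ x → agree x ∘ inj₂) ∘ h ∘ Sat-den-cong φ (λ x → sym ∘ agree x ∘ inj₁)
  Sat-den-cong (at x φ) agree {w} h =
    subst (λ c → Sat (withDen M _) w c φ) (agree x (inj₁ refl)) (Sat-den-cong φ (λ y → agree y ∘ inj₂) h)
  Sat-den-cong (F φ)    agree h = λ b asy → Sat-den-cong φ agree (h b asy)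
  Sat-den-cong (□ φ)    agree h = λ v r → Sat-den-cong φ agree (h v r)

  TrueLF-den-cong : {d d′ : Nom → A} {f : Label → W} (ι : LFm) → (∀ x → OccLF x ι → d x ≡ d′ x) →
                    TrueLF (withDen M d) f ι → TrueLF (withDen M d′) f ι
  TrueLF-den-cong {f = f} (lf β k χ) agree h =
    subst (λ c → Sat (withDen M _) (f β) c χ) (agree k (inj₂ (inj₁ refl)))
          (Sat-den-cong χ (λ x → agree x ∘ inj₂ ∘ inj₂) h)

  IsAssignment-den-cong : {d d′ : Nom → A} {f : Label → W} →
                          (∀ x → Any (OccL x) T → d x ≡ d′ x) →
                          IsAssignment (withDen M d) T f → IsAssignment (withDen M d′) T f
  IsAssignment-den-cong {f = f} agree asg β k i mem =
    subst (λ c → R c (f β) (f (child β k i))) (agree k (lose mem (inj₂ refl))) (asg β k i mem)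

module _ (M : Model) where
  open Model M

  subN-den-cong : den m ≡ den n → (k x : Nom) → den (subN m k x) ≡ den (subN n k x)
  subN-den-cong m=n k x with does (x ℕ.≟ k)
  ... | true  = m=n
  ... | false = refl

  Sat-subF : den m ≡ den n → (k : Nom) (ψ : Fm) {w : W} {a : A} →
             Sat M w a (subF m k ψ) → Sat M w a (subF n k ψ)
  Sat-subF m=n k (nom x)  h = trans (sym (subN-den-cong m=n k x)) h
  Sat-subF m=n k (var p)  h = h
  Sat-subF m=n k ⊥'       h = h
  Sat-subF m=n k (φ ⇒ ψ)  h = Sat-subF m=n k ψ ∘ h ∘ Sat-subF (sym m=n) k φ
  Sat-subF m=n k (at x φ) {w} h =
    subst (λ c → Sat M w c (subF _ k φ)) (subN-den-cong m=n k x) (Sat-subF m=n k φ h)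
  Sat-subF m=n k (F φ)    h = λ b asy → Sat-subF m=n k φ (h b asy)
  Sat-subF m=n k (□ φ)    h = λ v r → Sat-subF m=n k φ (h v r)

IsAssignment-⊆ : (M : Model) {f : Label → Model.W M} → T ⊆ T′ →
                 IsAssignment M T′ f → IsAssignment M T f
IsAssignment-⊆ M T⊆T′ asg β k i mem = asg β k i (T⊆T′ mem)

module _ (_≟_ : DecidableEquality Label) (M : Model) where
  open Model M
  open Update _≟_

  IsAssignment-extend : {f : Label → W} {v : W} → IsTree T → α ∈ T → child α n i ∉ T →
                        IsAssignment M T f → R (den n) (f α) v →
                        IsAssignment M (child α n i ∷ T) (f [ child α n i ]≔ v)
  IsAssignment-extend {T = T} {α = α} {n = n} {i = i} {f = f} {v} tree α∈T c∉T asg r = extended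
    where
    outside : ∀ {γ} → γ ∈ T → (f [ child α n i ]≔ v) γ ≡ f γ
    outside = []≔-outside {R = _∈ T} {f = f} {v = v} c∉T

    extended : IsAssignment M (child α n i ∷ T) (f [ child α n i ]≔ v)
    extended β k j (here refl) =
      subst₂ (R (den k)) (sym (outside α∈T)) (sym ([]≔-updates f (child β k j) v)) r
    extended β k j (there mem) =
      subst₂ (R (den k)) (sym (outside (IsTree.parentClosed tree β k j mem))) (sym (outside mem))
             (asg β k j mem)

TrueLF-assignment-cong : (M : Model) {f g : Label → Model.W M} (ι : LFm) →
                         f (lab ι) ≡ g (lab ι) → TrueLF M f ι → TrueLF M g ι
TrueLF-assignment-cong M (lf β k χ) f=g = subst (λ w → Sat M w (Model.den M k) χ) f=g

Valid : List LFm → List Label → List LFm → Set₁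
Valid Γ T Δ = (M : Model) (f : Label → Model.W M) → IsAssignment M T f → TrueSeq M f Γ Δ

init⊥-valid : Valid (lf α n ⊥' ∷ Γ) T Δ
init⊥-valid M f asg (() ∷ _)

initId-valid : Valid (ι ∷ Γ) T (ι ∷ Δ)
initId-valid M f asg (h ∷ _) = here h

-- The truth of α : @_{j[m/k]} ψ[m/k] is that of (@ⱼ ψ)[m/k] at any agent.
rep₁-valid : Valid (lf α n (nom m) ∷ lf α (subN n k j) (subF n k ψ) ∷ Γ) T Δ →
             Valid (lf α n (nom m) ∷ lf α (subN m k j) (subF m k ψ) ∷ Γ) T Δ
rep₁-valid {n = n} {k = k} {j = j} {ψ = ψ} d M f asg (m=n ∷ h ∷ hΓ) =
  d M f asg (m=n ∷ Sat-subF M m=n k (at j ψ) {a = Model.den M n} h ∷ hΓ)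

rep₂-valid : Valid (lf α n (nom m) ∷ lf α (subN m k j) (subF m k ψ) ∷ Γ) T Δ →
             Valid (lf α n (nom m) ∷ lf α (subN n k j) (subF n k ψ) ∷ Γ) T Δ
rep₂-valid {n = n} {k = k} {j = j} {ψ = ψ} d M f asg (m=n ∷ h ∷ hΓ) =
  d M f asg (m=n ∷ Sat-subF M (sym m=n) k (at j ψ) {a = Model.den M n} h ∷ hΓ)

ref=-valid : Valid (lf α n (nom n) ∷ Γ) T Δ → Valid Γ T Δ
ref=-valid d M f asg hΓ = d M f asg (refl ∷ hΓ)

rigid=-valid : Valid (lf β n (nom m) ∷ Γ) T Δ → Valid (lf α n (nom m) ∷ Γ) T Δ
rigid=-valid d M f asg (h ∷ hΓ) = d M f asg (h ∷ hΓ)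

⇒L-valid : Valid Γ T (lf α n φ ∷ Δ) → Valid (lf α n ψ ∷ Γ) T Δ →
           Valid (lf α n (φ ⇒ ψ) ∷ Γ) T Δ
⇒L-valid d₁ d₂ M f asg (h ∷ hΓ) =
  [ (λ p → d₂ M f asg (h p ∷ hΓ)) , id ]′ (Any.toSum (d₁ M f asg hΓ))

-- α : @ₙ @ₘ φ and α : @ₘ φ have the same truth condition; only the list index changes.
atR-valid : Valid Γ T (lf α m φ ∷ Δ) → Valid Γ T (lf α n (at m φ) ∷ Δ)
atR-valid d M f asg hΓ = Any.fromSum (Any.toSum (d M f asg hΓ))

atL-valid : Valid (lf α m φ ∷ Γ) T Δ → Valid (lf α n (at m φ) ∷ Γ) T Δ
atL-valid d M f asg (h ∷ hΓ) = d M f asg (h ∷ hΓ)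

□L-valid : child α n i ∈ T → Valid (lf (child α n i) n φ ∷ Γ) T Δ →
           Valid (lf α n (□ φ) ∷ Γ) T Δ
□L-valid {α = α} {n} {i} c∈T d M f asg (h ∷ hΓ) = d M f asg (h _ (asg α n i c∈T) ∷ hΓ)

wlab-valid : Valid Γ T Δ → Valid Γ (β ∷ T) Δ
wlab-valid d M f asg = d M f (IsAssignment-⊆ M there asg)

cut-valid : Valid Γ T (ι ∷ Δ) → Valid (ι ∷ Π) T Σ′ → Valid (Γ ++ Π) T (Δ ++ Σ′)
cut-valid {Γ = Γ} {Δ = Δ} d₁ d₂ M f asg hΓΠ with ++⁻ Γ hΓΠ
... | hΓ , hΠ = [ (λ p → ++⁺ʳ Δ (d₂ M f asg (p ∷ hΠ))) , ++⁺ˡ ]′ (Any.toSum (d₁ M f asg hΓ))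

set-valid : Γ ≋ Π → T ≋ T′ → Δ ≋ Σ′ → Valid Γ T Δ → Valid Π T′ Σ′
set-valid Γ≋Π T≋T′ Δ≋Σ′ d M f asg hΠ =
  Any-resp-⊆ (≋⇒⊆ Δ≋Σ′) (d M f (IsAssignment-⊆ M (≋⇒⊆ T≋T′) asg) (All-resp-⊇ (≋⇒⊆ Γ≋Π) hΠ))

module _ (em : ExcludedMiddle 0ℓ) where

  ⇒R-valid : Valid (lf α n φ ∷ Γ) T (lf α n ψ ∷ Δ) → Valid Γ T (lf α n (φ ⇒ ψ) ∷ Δ)
  ⇒R-valid d M f asg hΓ = Any-∷-classical em λ ¬Δ s → Any.head ¬Δ (d M f asg (s ∷ hΓ))

  FL-valid : Valid Γ T (lf α n (⟨F⟩ (nom m)) ∷ Δ) → Valid (lf α m φ ∷ Γ) T Δ →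
             Valid (lf α n (F φ) ∷ Γ) T Δ
  FL-valid {α = α} {m = m} {φ = φ} d₁ d₂ M f asg (h ∷ hΓ) with em {Sat M (f α) (Model.den M m) φ}
  ... | yes s = d₂ M f asg (s ∷ hΓ)
  ... | no ¬s =
    [ (λ ¬F¬m → contradiction (λ b asy m=b → ¬s (subst (λ c → Sat M (f α) c φ) (sym m=b) (h b asy))) ¬F¬m)
    , id ]′ (Any.toSum (d₁ M f asg hΓ))

  FR-valid : FreshNom m Γ T (lf α n (F φ) ∷ Δ) →
             Valid (lf α n (⟨F⟩ (nom m)) ∷ Γ) T (lf α m φ ∷ Δ) → Valid Γ T (lf α n (F φ) ∷ Δ)
  FR-valid {m = m} {Γ = Γ} {T = T} {α = α} {n = n} {φ = φ} {Δ = Δ} (m∉Γ , m∉FΔ , m∉T) d M f asg hΓ =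
    Any-∷-classical em every-successor
    where
    open Model M
    open Update ℕ._≟_

    every-successor : ¬ Any (TrueLF M f) Δ → ∀ b → Asy (f α) (den n) b → Sat M (f α) b φ
    every-successor ¬Δ b asy = from-premise (d M′ f asg′ (⟨F⟩m ∷ hΓ′))
      where
      M′ : Model
      M′ = withDen M (den [ m ]≔ b)

      unchanged : {R : Nom → Set} → ¬ R m → ∀ x → R x → (den [ m ]≔ b) x ≡ den x
      unchanged {R} ¬Rm x = []≔-outside {R = R} {f = den} {v = b} ¬Rm

      asg′ : IsAssignment M′ T f
      asg′ = IsAssignment-den-cong M (λ x → sym ∘ unchanged {λ y → Any (OccL y) T} m∉T x) asg

      hΓ′ : All (TrueLF M′ f) Γ
      hΓ′ = All.zipWith (λ {ι} (¬o , h) → TrueLF-den-cong M {f = f} ι (λ x → sym ∘ unchanged ¬o x) h)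
                        (¬Any⇒All¬ Γ m∉Γ , hΓ)

      ⟨F⟩m : TrueLF M′ f (lf α n (⟨F⟩ (nom m)))
      ⟨F⟩m ¬m = ¬m b (subst (λ c → Asy (f α) c b) (sym n-unchanged) asy) ([]≔-updates den m b)
        where
        n-unchanged : (den [ m ]≔ b) n ≡ den n
        n-unchanged = unchanged {_≡ n} (m∉FΔ ∘ here ∘ inj₂ ∘ inj₁) n refl

      from-premise : Any (TrueLF M′ f) (lf α m φ ∷ Δ) → Sat M (f α) b φ
      from-premise (here s)  =
        Sat-den-cong M φ (unchanged (m∉FΔ ∘ here ∘ inj₂ ∘ inj₂))
                     (subst (λ c → Sat M′ (f α) c φ) ([]≔-updates den m b) s)
      from-premise (there a) = contradiction
        (Any-map-under-All (¬Any⇒All¬ Δ (m∉FΔ ∘ there)) (λ {ι} ¬o → TrueLF-den-cong M {f = f} ι (unchanged ¬o)) a) ¬Δ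

  □R-valid : WF Γ T (lf α n (□ φ) ∷ Δ) → child α n i ∉ T →
             Valid Γ (child α n i ∷ T) (lf (child α n i) n φ ∷ Δ) → Valid Γ T (lf α n (□ φ) ∷ Δ)
  □R-valid {Γ = Γ} {T = T} {α = α} {n = n} {φ = φ} {Δ = Δ} {i = i} (tree , Γ⊆T , α∈T ∷ Δ⊆T) c∉T d M f asg hΓ =
    Any-∷-classical em every-successor
    where
    open Model M
    open Update {Label} (λ _ _ → em)

    c : Label
    c = child α n i

    every-successor : ¬ Any (TrueLF M f) Δ → ∀ v → R (den n) (f α) v → Sat M v (den n) φ
    every-successor ¬Δ v r =
      from-premise (d M f′ (IsAssignment-extend (λ _ _ → em) M tree α∈T c∉T asg r) hΓ′)
      where
      f′ : Label → W
      f′ = f [ c ]≔ v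

      f′-outside : ∀ {γ} → γ ∈ T → f′ γ ≡ f γ
      f′-outside = []≔-outside {R = _∈ T} {f = f} {v = v} c∉T

      hΓ′ : All (TrueLF M f′) Γ
      hΓ′ = All.zipWith (λ {ι} (γ∈T , h) → TrueLF-assignment-cong M {f} {f′} ι (sym (f′-outside γ∈T)) h)
                        (Γ⊆T , hΓ)

      from-premise : Any (TrueLF M f′) (lf c n φ ∷ Δ) → Sat M v (den n) φ
      from-premise (here s)  = subst (λ w → Sat M w (den n) φ) ([]≔-updates f c v) s
      from-premise (there a) = contradiction
        (Any-map-under-All Δ⊆T (λ {ι} γ∈T → TrueLF-assignment-cong M {f′} {f} ι (f′-outside γ∈T)) a) ¬Δ

  ⊢-valid : ⊢ Γ T Δ → Valid Γ T Δ
  ⊢-valid (init⊥ _)             = init⊥-valid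
  ⊢-valid (initId _)            = initId-valid
  ⊢-valid (rep₁ {j = j} _ d)    = rep₁-valid {j = j} (⊢-valid d)
  ⊢-valid (rep₂ {j = j} _ d)    = rep₂-valid {j = j} (⊢-valid d)
  ⊢-valid (ref= _ _ d)          = ref=-valid (⊢-valid d)
  ⊢-valid (rigid= _ _ d)        = rigid=-valid (⊢-valid d)
  ⊢-valid (⇒R _ d)              = ⇒R-valid (⊢-valid d)
  ⊢-valid (⇒L _ d₁ d₂)          = ⇒L-valid (⊢-valid d₁) (⊢-valid d₂)
  ⊢-valid (atR _ d)             = atR-valid (⊢-valid d)
  ⊢-valid (atL _ d)             = atL-valid (⊢-valid d)
  ⊢-valid (FR _ fresh d)        = FR-valid fresh (⊢-valid d)
  ⊢-valid (FL _ d₁ d₂)          = FL-valid (⊢-valid d₁) (⊢-valid d₂)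
  ⊢-valid (□R wf c∉T d)         = □R-valid wf c∉T (⊢-valid d)
  ⊢-valid (□L _ c∈T d)          = □L-valid c∈T (⊢-valid d)
  ⊢-valid (wlab _ d)            = wlab-valid (⊢-valid d)
  ⊢-valid (cut _ d₁ d₂)         = cut-valid (⊢-valid d₁) (⊢-valid d₂)
  ⊢-valid (set _ Γ≋ T≋ Δ≋ d)    = set-valid Γ≋ T≋ Δ≋ (⊢-valid d)

theorem1 : ExcludedMiddle 0ℓ →
    (Γ : List LFm) (T : List Label) (Δ : List LFm) → ⊢ Γ T Δ →
    (M : Model) (f : Label → Model.W M) → IsAssignment M T f →
    TrueSeq M f Γ Δ
theorem1 em _ _ _ = ⊢-valid em
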